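{- Consider a phase with requests $r^1,\dots,r^\ell$. Then for every $d$, the set $\bigcup_{t=1}^{\ell}\mathcal{F}^t$ contains at most $k!/d!$ spaces of dimension $d$.
   Context: Let $U_1,\dots,U_k$ be finite sets. A configuration $c\in\prod_{i=1}^kU_i$ satisfies a request $r\in\prod_{i=1}^kU_i$ if $c_i=r_i$ for some $i$. For $v\in\prod_{i=1}^k(U_i\cup\{*\})$, the space $S(v)=\{c: c_i=v_i \text{ whenever } v_i\neq *\}$; its dimension is the number of coordinates with $v_i=*$ (free coordinates). Families $\mathcal{F}^t$ of spaces are maintained over a phase with requests $r^1,\dots,r^\ell$ as follows. $\mathcal{F}^1=\{S((r^1_1,*,\dots,*)),\dots,S((*,\dots,*,r^1_k))\}$ (the $k$ spaces of dimension $k-1$ obtained by fixing exactly coordinate $i$ to $r^1_i$). For $t\ge2$, $\mathcal{F}^t$ is obtained from $\mathcal{F}^{t-1}$ by: removing every $0$-dimensional space whose single configuration does not satisfy $r^t$; and replacing every space $S(v)\in\mathcal{F}^{t-1}$ of dimension $d>0$ that contains a configuration not satisfying $r^t$ by the $d$ spaces $S(v^{(j)})$, one for each free coordinate $j$ of $v$, where $v^{(j)}$ agrees with $v$ except that $v^{(j)}_j=r^t_j$; spaces not containing any configuration infeasible for $r^t$ are kept. The phase consists of the requests processed until $\mathcal{F}^t$ becomes empty. -}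

module Defs where

open import Data.Nat using (ℕ; zero; suc; _+_; _<_)
open import Data.Fin using (Fin)
open import Data.Fin.Properties using (_≟_)
open import Data.Maybe using (Maybe; just; nothing)
open import Data.List using (List; map; allFin)
open import Data.Nat.ListAction using (sum)
open import Data.Product using (Σ; ∃; _×_)
open import Data.Sum using (_⊎_)
open import Relation.Binary.PropositionalEquality using (_≡_; _≢_; refl)
import Relation.Nullary
import Data.Empty

-- The finite sets U_i are Fin (n i), for i : Fin k.

Config : (k : ℕ) → (Fin k → ℕ) → Set
Config k n = (i : Fin k) → Fin (n i)

-- Vectors v ∈ ∏ (U_i ∪ {*}); nothing plays the role of *.
Pattern : (k : ℕ) → (Fin k → ℕ) → Set
Pattern k n = (i : Fin k) → Maybe (Fin (n i))

freeInd : {A : Set} → Maybe A → ℕ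
freeInd nothing  = 1
freeInd (just _) = 0

module _ {k : ℕ} {n : Fin k → ℕ} where

  Satisfies : Config k n → Config k n → Set
  Satisfies c r = ∃ λ i → c i ≡ r i

  _∈S_ : Config k n → Pattern k n → Set
  c ∈S v = ∀ i → (a : Fin (n i)) → v i ≡ just a → c i ≡ a

  dim : Pattern k n → ℕ
  dim v = sum (map (λ i → freeInd (v i)) (allFin k))

  _≈_ : Pattern k n → Pattern k n → Set
  v ≈ w = ∀ i → v i ≡ w i

  setCoord : Pattern k n → (j : Fin k) → Fin (n j) → Pattern k n
  setCoord v j a i with i ≟ j
  ... | Relation.Nullary.yes refl = just a
  ... | Relation.Nullary.no  _    = v i

  fixOne : (j : Fin k) → Fin (n j) → Pattern k n
  fixOne j a = setCoord (λ _ → nothing) j a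

  HasInfeasible : Pattern k n → Config k n → Set
  HasInfeasible v r = ∃ λ c → c ∈S v × (¬Sat c r)
    where
    ¬Sat : Config k n → Config k n → Set
    ¬Sat c r = Satisfies c r → Data.Empty.⊥

  -- Families F^t, as predicates on patterns (a space S(v) is in the
  -- family iff w ∈ F holds for v).  Index t : ℕ corresponds to F^{t+1}
  -- of the paper; the requests are r 0, r 1, … (r t = r^{t+1}).
  -- Step: S(w) ∈ F^t iff there is S(v) ∈ F^{t-1} such that either
  --   S(v) has no configuration infeasible for r^t and w = v (kept), or
  --   S(v) has an infeasible configuration and w = v^{(j)} for a free
  --   coordinate j of v (replaced; for dim 0 there is no such j, i.e. removed).
  Fam : (ℕ → Config k n) → ℕ → Pattern k n → Set
  Fam r zero w = ∃ λ j → w ≈ fixOne j (r zero j)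
  Fam r (suc t) w = ∃ λ v → Fam r t v ×
      (((HasInfeasible v (r (suc t)) → Data.Empty.⊥) × w ≈ v)
       ⊎ (HasInfeasible v (r (suc t)) ×
          (∃ λ j → v j ≡ nothing × w ≈ setCoord v j (r (suc t) j))))

module Submission where

-- Adjoin the whole space S(*,…,*) as a root: every space
-- of the phase then arises from a unique "parent" space by fixing one
-- free coordinate j (F^1 comes from the root, every later space either
-- is kept or comes from a split space).  Because all configurations in
-- a space of F^t satisfy r^1,…,r^t, a space is split at most once, so a
-- child is determined by its parent and the coordinate j; as j ranges
-- over the free coordinates of the parent, a parent of dimension d+1 has
-- at most d+1 children.  Hence the number N_d of spaces of dimension d
-- satisfies N_k ≤ 1 (only the root) and N_d ≤ (d+1)·N_{d+1}, which gives
-- N_d ≤ k!/d! by downward induction on d.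

open import Defs
open import Data.Bool using (true; false)
open import Data.Nat using (ℕ; zero; suc; _+_; _*_; _∸_; _<_; _≤_; _/_; _!; z≤n; s≤s; s≤s⁻¹; NonZero)
open import Data.Nat.Properties
open import Data.Nat.DivMod using (n/n≡1; m*n/n≡m)
open import Data.Nat.Divisibility using (divides; m≤n⇒m!∣n!)
open import Data.Nat.ListAction using (sum)
open import Data.Fin using (Fin)
import Data.Fin.Properties as Fin
open import Data.Maybe using (Maybe; just; nothing)
import Data.Maybe.Properties as Maybe
open import Data.List using (List; []; _∷_; length; map; filter; allFin; tabulate)
import Data.List.Properties as List
open import Data.List.Membership.Propositional using (_∈_)
open import Data.List.Membership.Propositional.Properties using (∈-filter⁺; ∈-allFin)
open import Data.List.Relation.Unary.Any using (here; there; _─_)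
open import Data.List.Relation.Unary.All as All using (All; []; _∷_)
import Data.List.Relation.Unary.All.Properties as All
open import Data.List.Relation.Unary.AllPairs using (AllPairs; []; _∷_)
import Data.List.Relation.Unary.AllPairs.Properties as AllPairs
open import Data.Product using (Σ; ∃; ∃₂; _×_; _,_; proj₁; proj₂)
open import Data.Sum using (_⊎_; inj₁; inj₂)
open import Data.Empty using (⊥-elim)
open import Function using (_∘_; _on_)
open import Relation.Nullary using (¬_; Dec; yes; no; does)
open import Relation.Nullary.Decidable using (decidable-stable)
open import Relation.Unary.Properties using (∁?)
open import Relation.Binary.PropositionalEquality
open import Relation.Binary.Definitions using (tri<; tri≈; tri>)

module _ {A : Set} where

  ∈-─ : ∀ {x y : A} {ys} (y∈ys : y ∈ ys) (x∈ys : x ∈ ys) → x ≢ y → y ∈ (ys ─ x∈ys)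
  ∈-─ (here refl)  (here refl)  x≢y = ⊥-elim (x≢y refl)
  ∈-─ (there y∈ys) (here refl)  _   = y∈ys
  ∈-─ (here refl)  (there _)    _   = here refl
  ∈-─ (there y∈ys) (there x∈ys) x≢y = there (∈-─ y∈ys x∈ys x≢y)

  unique-⊆⇒length≤ : ∀ {xs ys : List A} →
    AllPairs _≢_ xs → All (_∈ ys) xs → length xs ≤ length ys
  unique-⊆⇒length≤ [] [] = z≤n
  unique-⊆⇒length≤ {x ∷ xs} {ys} (x≢xs ∷ xs!) (x∈ys ∷ xs⊆ys) = begin
    suc (length xs)          ≤⟨ s≤s (unique-⊆⇒length≤ xs! xs⊆ys─x) ⟩
    suc (length (ys ─ x∈ys)) ≡⟨ List.length-removeAt′ ys _ ⟨
    length ys                ∎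
    where
    open ≤-Reasoning
    xs⊆ys─x : All (_∈ (ys ─ x∈ys)) xs
    xs⊆ys─x = All.zipWith (λ (x≢y , y∈ys) → ∈-─ y∈ys x∈ys x≢y) (x≢xs , xs⊆ys)

length-filter-∁ : {A : Set} {P : A → Set} (P? : ∀ x → Dec (P x)) (xs : List A) →
  length (filter P? xs) + length (filter (∁? P?) xs) ≡ length xs
length-filter-∁ P? [] = refl
length-filter-∁ P? (x ∷ xs) with does (P? x)
... | true  = cong suc (length-filter-∁ P? xs)
... | false = trans (+-suc _ _) (cong suc (length-filter-∁ P? xs))

map-proj₁-toList : {A : Set} {P : A → Set} {xs : List A} (pxs : All P xs) →
  map proj₁ (All.toList pxs) ≡ xs
map-proj₁-toList []         = refl
map-proj₁-toList (_ ∷ pxs) = cong (_ ∷_) (map-proj₁-toList pxs)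

-- Induction on B: the fibre of the first
-- element is removed, and its parent is excluded from Q.
module FibreCounting
  {X Y : Set} {_#ˣ_ : X → X → Set} {_#_ _≈_ : Y → Y → Set}
  (_≈?_ : ∀ y y′ → Dec (y ≈ y′)) (≉⇒# : ∀ {y y′} → ¬ (y ≈ y′) → y # y′)
  (parent : X → Y) (m : ℕ)
  (fibre-bound : ∀ x xs → AllPairs _#ˣ_ xs →
                 All (λ x′ → parent x ≈ parent x′) xs → length xs ≤ m)
  where

  fibre-count : ∀ B {Q : Y → Set} →
    (∀ ys → AllPairs _#_ ys → All Q ys → length ys ≤ B) →
    ∀ xs → AllPairs _#ˣ_ xs → All (Q ∘ parent) xs → length xs ≤ m * B
  fibre-count B       bound []       _ _ = z≤n
  fibre-count zero    bound (x ∷ _)  _ (qx ∷ _) =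
    ⊥-elim (1+n≰n (bound (parent x ∷ []) ([] ∷ []) (qx ∷ [])))
  fibre-count (suc B) {Q} bound (x ∷ xs) apart (qx ∷ qxs) = begin
    length (x ∷ xs)
      ≡⟨ length-filter-∁ same? (x ∷ xs) ⟨
    length (filter same? (x ∷ xs)) + length (filter (∁? same?) (x ∷ xs))
      ≤⟨ +-mono-≤ (fibre-bound x _ (AllPairs.filter⁺ same? apart)
                                   (All.all-filter same? (x ∷ xs)))
                  (fibre-count B bound′ _ (AllPairs.filter⁺ (∁? same?) apart) others) ⟩
    m + m * B
      ≡⟨ *-suc m B ⟨
    m * suc B ∎
    where
    open ≤-Reasoning
    same? : ∀ x′ → Dec (parent x ≈ parent x′)
    same? x′ = parent x ≈? parent x′
    Q′ : Y → Set
    Q′ y = Q y × parent x # y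
    bound′ : ∀ ys → AllPairs _#_ ys → All Q′ ys → length ys ≤ B
    bound′ ys apart′ q′s =
      s≤s⁻¹ (bound (parent x ∷ ys) (All.map proj₂ q′s ∷ apart′) (qx ∷ All.map proj₁ q′s))
    others : All (Q′ ∘ parent) (filter (∁? same?) (x ∷ xs))
    others = All.zipWith (λ (q , ≉) → q , ≉⇒# ≉)
      (All.filter⁺ (∁? same?) (qx ∷ qxs) , All.all-filter (∁? same?) (x ∷ xs))

sum-tabulate-step : ∀ {m} (f g : Fin m → ℕ) (j : Fin m) → f j ≡ suc (g j) →
  (∀ i → i ≢ j → f i ≡ g i) → sum (tabulate f) ≡ suc (sum (tabulate g))
sum-tabulate-step f g Fin.zero fj others =
  cong₂ _+_ fj (cong sum (List.tabulate-cong (λ i → others (Fin.suc i) λ ())))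
sum-tabulate-step f g (Fin.suc j) fj others = begin
  f Fin.zero + sum (tabulate (f ∘ Fin.suc))
    ≡⟨ cong₂ _+_ (others Fin.zero λ ())
                 (sum-tabulate-step (f ∘ Fin.suc) (g ∘ Fin.suc) j fj
                   (λ i i≢j → others (Fin.suc i) (i≢j ∘ Fin.suc-injective))) ⟩
  g Fin.zero + suc (sum (tabulate (g ∘ Fin.suc)))
    ≡⟨ +-suc _ _ ⟩
  suc (sum (tabulate g)) ∎
  where open ≡-Reasoning

factorial-ratio : ℕ → ℕ → ℕ
factorial-ratio k d = _/_ (k !) (d !) {{d !≢0}}

-- k!/d! = (d+1) · k!/(d+1)!  when d < k, since (d+1)! divides k!.
factorial-ratio-step : ∀ {k d} → d < k →
  factorial-ratio k d ≡ suc d * factorial-ratio k (suc d)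
factorial-ratio-step {k} {d} d<k with m≤n⇒m!∣n! d<k
... | divides q k!≡q*[1+d]! = begin
  k ! / d !                       ≡⟨ cong (_/ d !) k!≡q*[1+d]! ⟩
  q * (suc d * d !) / d !         ≡⟨ cong (_/ d !) (*-assoc q (suc d) (d !)) ⟨
  q * suc d * d ! / d !           ≡⟨ m*n/n≡m (q * suc d) (d !) ⟩
  q * suc d                       ≡⟨ *-comm q (suc d) ⟩
  suc d * q                       ≡⟨ cong (suc d *_) (m*n/n≡m q (suc d !)) ⟨
  suc d * (q * suc d ! / suc d !) ≡⟨ cong (λ x → suc d * (x / suc d !)) k!≡q*[1+d]! ⟨
  suc d * (k ! / suc d !)         ∎
  where
  open ≡-Reasoning
  instance
    d!≢0 : NonZero (d !)
    d!≢0 = d !≢0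
    [1+d]!≢0 : NonZero (suc d !)
    [1+d]!≢0 = suc d !≢0

nothing? : {A : Set} (a : Maybe A) → Dec (a ≡ nothing)
nothing? nothing  = yes refl
nothing? (just _) = no λ ()

sum-freeInd : {X : Set} {Y : X → Set} (f : (x : X) → Maybe (Y x)) (xs : List X) →
  sum (map (λ x → freeInd (f x)) xs) ≡ length (filter (λ x → nothing? (f x)) xs)
sum-freeInd f [] = refl
sum-freeInd f (x ∷ xs) with f x
... | nothing = cong suc (sum-freeInd f xs)
... | just _  = sum-freeInd f xs

module Spaces (k : ℕ) (n : Fin k → ℕ) where

  top : Pattern k n
  top _ = nothing

  ≈-refl : ∀ {v : Pattern k n} → v ≈ v
  ≈-refl _ = refl

  ≈-sym : ∀ {v w : Pattern k n} → v ≈ w → w ≈ v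
  ≈-sym v≈w i = sym (v≈w i)

  ≈-trans : ∀ {u v w : Pattern k n} → u ≈ v → v ≈ w → u ≈ w
  ≈-trans u≈v v≈w i = trans (u≈v i) (v≈w i)

  _≈?_ : ∀ (v w : Pattern k n) → Dec (v ≈ w)
  v ≈? w = Fin.all? (λ i → Maybe.≡-dec Fin._≟_ (v i) (w i))

  Distinct : Pattern k n → Pattern k n → Set
  Distinct v w = ∃ λ i → v i ≢ w i

  ≉⇒Distinct : ∀ {v w} → ¬ (v ≈ w) → Distinct v w
  ≉⇒Distinct {v} {w} = Fin.¬∀⟶∃¬ k _ (λ i → Maybe.≡-dec Fin._≟_ (v i) (w i))

  Distinct⇒≉ : ∀ {v w} → Distinct v w → ¬ (v ≈ w)
  Distinct⇒≉ (i , vᵢ≢wᵢ) v≈w = vᵢ≢wᵢ (v≈w i)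

  setCoord-same : ∀ v j (a : Fin (n j)) → setCoord v j a j ≡ just a
  setCoord-same v j a with j Fin.≟ j
  ... | yes refl = refl
  ... | no j≢j   = ⊥-elim (j≢j refl)

  setCoord-other : ∀ v j (a : Fin (n j)) {i} → i ≢ j → setCoord v j a i ≡ v i
  setCoord-other v j a {i} i≢j with i Fin.≟ j
  ... | yes refl = ⊥-elim (i≢j refl)
  ... | no _     = refl

  setCoord-cong : ∀ {v w} j (a : Fin (n j)) → v ≈ w → setCoord v j a ≈ setCoord w j a
  setCoord-cong j a v≈w i with i Fin.≟ j
  ... | yes refl = refl
  ... | no _     = v≈w i

  ∈S-resp-≈ : ∀ {c : Config k n} {v w} → v ≈ w → c ∈S v → c ∈S w
  ∈S-resp-≈ v≈w c∈v i a wᵢ≡a = c∈v i a (trans (v≈w i) wᵢ≡a)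

  ∈S-setCoord-parent : ∀ {c : Config k n} {v j} {a : Fin (n j)} →
    v j ≡ nothing → c ∈S setCoord v j a → c ∈S v
  ∈S-setCoord-parent {v = v} {j} {a} vⱼ-free c∈vʲ i b vᵢ≡b with i Fin.≟ j
  ... | yes refl = ⊥-elim (nothing≢just (trans (sym vⱼ-free) vᵢ≡b))
    where
    nothing≢just : ∀ {x : Fin (n i)} → nothing ≢ just x
    nothing≢just ()
  ... | no i≢j   = c∈vʲ i b (trans (setCoord-other v j a i≢j) vᵢ≡b)

  ∈S-setCoord-coord : ∀ {c : Config k n} {v j} {a : Fin (n j)} →
    c ∈S setCoord v j a → c j ≡ a
  ∈S-setCoord-coord {v = v} {j} {a} c∈vʲ = c∈vʲ j a (setCoord-same v j a)

  satisfies? : (c x : Config k n) → Dec (Satisfies c x)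
  satisfies? c x = Fin.any? (λ i → c i Fin.≟ x i)

  freeCoords : Pattern k n → List (Fin k)
  freeCoords v = filter (λ i → nothing? (v i)) (allFin k)

  dim-freeCoords : ∀ v → dim v ≡ length (freeCoords v)
  dim-freeCoords v = sum-freeInd v (allFin k)

  free-coordinates-bound : ∀ v {js : List (Fin k)} → AllPairs _≢_ js →
    All (λ j → v j ≡ nothing) js → length js ≤ dim v
  free-coordinates-bound v js! js-free =
    subst (_ ≤_) (sym (dim-freeCoords v))
      (unique-⊆⇒length≤ js! (All.map (∈-filter⁺ _ (∈-allFin _)) js-free))

  dim-≈ : ∀ {v w : Pattern k n} → v ≈ w → dim v ≡ dim w
  dim-≈ v≈w = cong sum (List.map-cong (cong freeInd ∘ v≈w) (allFin k))

  dim-top : dim top ≡ k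
  dim-top = trans (dim-freeCoords top)
    (trans (cong length (List.filter-all (λ i → nothing? (top i)) {allFin k}
                                         (All.tabulate λ _ → refl)))
           (List.length-tabulate {n = k} (λ i → i)))

  dim-child : ∀ {p w j} {a : Fin (n j)} → p j ≡ nothing → w ≈ setCoord p j a →
    dim p ≡ suc (dim w)
  dim-child {p} {w} {j} {a} pⱼ-free w≈pʲ = begin
    dim p                                 ≡⟨ as-sum p ⟩
    sum (tabulate (freeInd ∘ p))          ≡⟨ sum-tabulate-step _ _ j at-j elsewhere ⟩
    suc (sum (tabulate (freeInd ∘ w)))    ≡⟨ cong suc (as-sum w) ⟨
    suc (dim w)                           ∎
    where
    open ≡-Reasoning
    as-sum : ∀ v → dim v ≡ sum (tabulate (freeInd ∘ v))
    as-sum v = cong sum (List.map-tabulate (λ i → i) (freeInd ∘ v))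
    at-j : freeInd (p j) ≡ suc (freeInd (w j))
    at-j = trans (cong freeInd pⱼ-free)
                 (cong (suc ∘ freeInd) (sym (trans (w≈pʲ j) (setCoord-same p j a))))
    elsewhere : ∀ i → i ≢ j → freeInd (p i) ≡ freeInd (w i)
    elsewhere i i≢j = cong freeInd (sym (trans (w≈pʲ i) (setCoord-other p j a i≢j)))

  module Phase (r : ℕ → Config k n) where

    Member : Pattern k n → Set
    Member v = ∃ λ t → Fam r t v

    InTree : Pattern k n → Set
    InTree v = v ≈ top ⊎ Member v

    member-satisfies : ∀ t {v} → Fam r t v → ∀ {s} → s ≤ t →
      ∀ {c} → c ∈S v → Satisfies c (r s)
    member-satisfies zero (j , v≈) z≤n c∈v =
      j , ∈S-setCoord-coord (∈S-resp-≈ v≈ c∈v)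
    member-satisfies (suc t) (v , fv , step) s≤1+t {c} c∈w
      with m≤n⇒m<n∨m≡n s≤1+t | step
    ... | inj₁ s<1+t | inj₁ (_ , w≈v) =
      member-satisfies t fv (m<1+n⇒m≤n s<1+t) (∈S-resp-≈ w≈v c∈w)
    ... | inj₁ s<1+t | inj₂ (_ , j , vⱼ-free , w≈vʲ) =
      member-satisfies t fv (m<1+n⇒m≤n s<1+t)
        (∈S-setCoord-parent vⱼ-free (∈S-resp-≈ w≈vʲ c∈w))
    ... | inj₂ refl | inj₁ (feasible , w≈v) =
      decidable-stable (satisfies? c _) (λ c✗ → feasible (c , ∈S-resp-≈ w≈v c∈w , c✗))
    ... | inj₂ refl | inj₂ (_ , j , _ , w≈vʲ) =
      j , ∈S-setCoord-coord (∈S-resp-≈ w≈vʲ c∈w)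

    -- Hence a space (up to ≈) is split at most once: if it is still a
    -- member at a time t′ > t, all its configurations satisfy r (suc t).
    split-once : ∀ {t t′ p p′} → p ≈ p′ →
      Fam r t p → HasInfeasible p (r (suc t)) →
      Fam r t′ p′ → HasInfeasible p′ (r (suc t′)) → t ≡ t′
    split-once {t} {t′} p≈p′ fp (c , c∈p , c✗) fp′ (c′ , c′∈p′ , c′✗) with <-cmp t t′
    ... | tri< t<t′ _ _ = ⊥-elim (c✗ (member-satisfies t′ fp′ t<t′ (∈S-resp-≈ p≈p′ c∈p)))
    ... | tri≈ _ t≡t′ _ = t≡t′
    ... | tri> _ _ t′<t = ⊥-elim (c′✗ (member-satisfies t fp t′<t (∈S-resp-≈ (≈-sym p≈p′) c′∈p′)))

    member-dim : ∀ t {v} → Fam r t v → dim v < k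
    member-dim zero (j , v≈) =
      ≤-reflexive (trans (sym (dim-child refl v≈)) dim-top)
    member-dim (suc t) (v , fv , inj₁ (_ , w≈v)) =
      subst (_< k) (sym (dim-≈ w≈v)) (member-dim t fv)
    member-dim (suc t) (v , fv , inj₂ (_ , _ , vⱼ-free , w≈vʲ)) =
      <⇒≤ (subst (_< k) (dim-child vⱼ-free w≈vʲ) (member-dim t fv))

    member-≉top : ∀ t {v} → Fam r t v → ¬ (v ≈ top)
    member-≉top t fv v≈top = <-irrefl (trans (dim-≈ v≈top) dim-top) (member-dim t fv)

    in-tree-dim : ∀ {v} → InTree v → dim v ≤ k
    in-tree-dim (inj₁ v≈top)   = ≤-reflexive (trans (dim-≈ v≈top) dim-top)
    in-tree-dim (inj₂ (t , fv)) = <⇒≤ (member-dim t fv)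

    Origin : Pattern k n → Pattern k n → Fin k → Set
    Origin w p j =
      (p ≈ top × w ≈ fixOne j (r zero j))
      ⊎ (∃ λ t → Fam r t p × HasInfeasible p (r (suc t)) ×
                 p j ≡ nothing × w ≈ setCoord p j (r (suc t) j))

    origin-resp-≈ : ∀ {w w′ p j} → w ≈ w′ → Origin w′ p j → Origin w p j
    origin-resp-≈ w≈w′ (inj₁ (p≈top , e))        = inj₁ (p≈top , ≈-trans w≈w′ e)
    origin-resp-≈ w≈w′ (inj₂ (t , fp , hi , f , e)) = inj₂ (t , fp , hi , f , ≈-trans w≈w′ e)

    origin-exists : ∀ t {w} → Fam r t w → ∃₂ λ p j → Origin w p j
    origin-exists zero (j , w≈) = top , j , inj₁ (≈-refl , w≈)
    origin-exists (suc t) (v , fv , inj₁ (_ , w≈v)) =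
      let p , j , o = origin-exists t fv in p , j , origin-resp-≈ w≈v o
    origin-exists (suc t) (v , fv , inj₂ (hi , j , vⱼ-free , w≈vʲ)) =
      v , j , inj₂ (t , fv , hi , vⱼ-free , w≈vʲ)

    origin-free : ∀ {w p j} → Origin w p j → p j ≡ nothing
    origin-free {j = j} (inj₁ (p≈top , _))        = p≈top j
    origin-free         (inj₂ (_ , _ , _ , f , _)) = f

    origin-dim : ∀ {w p j} → Origin w p j → dim p ≡ suc (dim w)
    origin-dim (inj₁ (p≈top , w≈)) = trans (dim-≈ p≈top) (dim-child refl w≈)
    origin-dim (inj₂ (_ , _ , _ , f , w≈)) = dim-child f w≈

    origin-in-tree : ∀ {w p j} → Origin w p j → InTree p
    origin-in-tree (inj₁ (p≈top , _))          = inj₁ p≈top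
    origin-in-tree (inj₂ (t , fp , _ , _ , _)) = inj₂ (t , fp)

    origin-unique : ∀ {w₁ w₂ p₁ p₂ j} → Origin w₁ p₁ j → Origin w₂ p₂ j →
      p₁ ≈ p₂ → w₁ ≈ w₂
    origin-unique (inj₁ (_ , e₁)) (inj₁ (_ , e₂)) _ = ≈-trans e₁ (≈-sym e₂)
    origin-unique (inj₁ (p₁≈top , _)) (inj₂ (t , fp₂ , _)) p₁≈p₂ =
      ⊥-elim (member-≉top t fp₂ (≈-trans (≈-sym p₁≈p₂) p₁≈top))
    origin-unique (inj₂ (t , fp₁ , _)) (inj₁ (p₂≈top , _)) p₁≈p₂ =
      ⊥-elim (member-≉top t fp₁ (≈-trans p₁≈p₂ p₂≈top))
    origin-unique {j = j} (inj₂ (t₁ , fp₁ , hi₁ , _ , e₁)) (inj₂ (t₂ , fp₂ , hi₂ , _ , e₂)) p₁≈p₂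
      with split-once p₁≈p₂ fp₁ hi₁ fp₂ hi₂
    ... | refl = ≈-trans e₁ (≈-trans (setCoord-cong j _ p₁≈p₂) (≈-sym e₂))

    Level : ℕ → Pattern k n → Set
    Level d v = dim v ≡ d × InTree v

    Bounded : ℕ → Set
    Bounded d = ∀ L → AllPairs Distinct L → All (Level d) L → length L ≤ factorial-ratio k d

    ChildOf : ℕ → Pattern k n → Set
    ChildOf d w = dim w ≡ d × ∃₂ λ p j → Origin w p j

    Child : ℕ → Set
    Child d = Σ (Pattern k n) (ChildOf d)

    module _ {d : ℕ} where

      parent : Child d → Pattern k n
      parent (_ , _ , p , _ , _) = p

      label : Child d → Fin k
      label (_ , _ , _ , j , _) = j

      origin : (x : Child d) → Origin (proj₁ x) (parent x) (label x)
      origin (_ , _ , _ , _ , o) = o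

      as-child : d < k → ∀ {w} → Level d w → ChildOf d w
      as-child d<k (dw , inj₁ w≈top) =
        ⊥-elim (<-irrefl (trans (sym dw) (trans (dim-≈ w≈top) dim-top)) d<k)
      as-child d<k (dw , inj₂ (t , fw)) = dw , origin-exists t fw

      parent-level : ∀ x → Level (suc d) (parent x)
      parent-level (_ , dw , _ , _ , o) = trans (origin-dim o) (cong suc dw) , origin-in-tree o

      same-label : ∀ x₁ x₂ → parent x₁ ≈ parent x₂ → label x₁ ≡ label x₂ →
        proj₁ x₁ ≈ proj₁ x₂
      same-label (_ , _ , _ , _ , o₁) (_ , _ , _ , _ , o₂) p₁≈p₂ refl = origin-unique o₁ o₂ p₁≈p₂

      fibre-bound : ∀ x xs → AllPairs (Distinct on proj₁) xs →
        All (λ x′ → parent x ≈ parent x′) xs → length xs ≤ suc d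
      fibre-bound x xs apart same = begin
        length xs             ≡⟨ List.length-map label xs ⟨
        length (map label xs) ≤⟨ free-coordinates-bound (parent x)
                                   (AllPairs.map⁺ (labels-distinct same apart))
                                   (All.map⁺ {f = label} (All.map (λ {x′} → free {x′}) same)) ⟩
        dim (parent x)        ≡⟨ proj₁ (parent-level x) ⟩
        suc d                 ∎
        where
        open ≤-Reasoning
        free : ∀ {x′} → parent x ≈ parent x′ → parent x (label x′) ≡ nothing
        free {x′} p≈p′ = trans (p≈p′ (label x′)) (origin-free (origin x′))
        labels-distinct : ∀ {ys} → All (λ x′ → parent x ≈ parent x′) ys →
          AllPairs (Distinct on proj₁) ys → AllPairs (_≢_ on label) ys
        labels-distinct [] [] = []
        labels-distinct {x₁ ∷ _} (s₁ ∷ ss) (d₁ ∷ ds) =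
          All.zipWith (λ {x₂} (s₂ , d₁₂) →
                         Distinct⇒≉ d₁₂ ∘ same-label x₁ x₂ (≈-trans (≈-sym s₁) s₂))
                      (ss , d₁)
          ∷ labels-distinct ss ds

    -- At the top level only the root is left.
    level-top : Bounded k
    level-top L apart levels =
      subst (length L ≤_) (sym (n/n≡1 (k !) {{k !≢0}})) (at-most-one apart (All.map root levels))
      where
      root : ∀ {v} → Level k v → v ≈ top
      root (_ , inj₁ v≈top)      = v≈top
      root (dv , inj₂ (t , fv)) = ⊥-elim (<-irrefl dv (member-dim t fv))
      at-most-one : ∀ {vs} → AllPairs Distinct vs → All (_≈ top) vs → length vs ≤ 1
      at-most-one [] [] = z≤n
      at-most-one (_ ∷ []) (_ ∷ []) = s≤s z≤n
      at-most-one ((d₁₂ ∷ _) ∷ _) (v₁≈ ∷ v₂≈ ∷ _) =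
        ⊥-elim (Distinct⇒≉ d₁₂ (≈-trans v₁≈ (≈-sym v₂≈)))

    -- N_d ≤ (d+1)·N_{d+1}: count the spaces of dimension d through their parents.
    level-step : ∀ {d} → d < k → Bounded (suc d) → Bounded d
    level-step {d} d<k bound L apart levels = begin
      length L                        ≡⟨ cong length (map-proj₁-toList children) ⟨
      length (map proj₁ xs)           ≡⟨ List.length-map proj₁ xs ⟩
      length xs                       ≤⟨ fibre-count (factorial-ratio k (suc d)) bound xs
                                           (AllPairs.map⁻ apart′)
                                           (All.tabulate λ {x} _ → parent-level x) ⟩
      suc d * factorial-ratio k (suc d) ≡⟨ factorial-ratio-step d<k ⟨
      factorial-ratio k d             ∎
      where
      open ≤-Reasoning
      open FibreCounting _≈?_ ≉⇒Distinct (parent {d}) (suc d) fibre-bound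
      children : All (ChildOf d) L
      children = All.map (as-child d<k) levels
      xs : List (Child d)
      xs = All.toList children
      apart′ : AllPairs Distinct (map proj₁ xs)
      apart′ = subst (AllPairs Distinct) (sym (map-proj₁-toList children)) apart

    beyond-top : ∀ {d} → k < d → Bounded d
    beyond-top k<d []      _ _                 = z≤n
    beyond-top k<d (_ ∷ _) _ ((dv , tv) ∷ _) =
      ⊥-elim (<⇒≱ k<d (subst (_≤ k) dv (in-tree-dim tv)))

    below-top : ∀ m d → d + m ≡ k → Bounded d
    below-top zero    d d+0≡k = subst Bounded (sym (trans (sym (+-identityʳ d)) d+0≡k)) level-top
    below-top (suc m) d d+m+1≡k = level-step d<k (below-top m (suc d) d+1+m≡k)
      where
      d+1+m≡k : suc d + m ≡ k
      d+1+m≡k = trans (sym (+-suc d m)) d+m+1≡k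
      d<k : d < k
      d<k = subst (suc d ≤_) d+1+m≡k (m≤m+n (suc d) m)

    bounded : ∀ d → Bounded d
    bounded d with d ≤? k
    ... | yes d≤k = below-top (k ∸ d) d (m+[n∸m]≡n d≤k)
    ... | no  d≰k = beyond-top (≰⇒> d≰k)

-- The theorem.
lemma2 : (k : ℕ) (n : Fin k → ℕ) (ℓ : ℕ) (r : ℕ → Config k n) →
         (∀ t → suc t < ℓ → ∃ λ v → Fam r t v) →
         (d : ℕ) (L : List (Pattern k n)) →
         AllPairs (λ v w → ∃ λ i → v i ≢ w i) L →
         All (λ v → dim v ≡ d × (∃ λ t → t < ℓ × Fam r t v)) L →
         length L ≤ _/_ (k !) (d !) {{d !≢0}}
lemma2 k n ℓ r _ d L apart spaces =
  Phase.bounded r d L apart (All.map (λ (dv , t , _ , fv) → dv , inj₂ (t , fv)) spaces)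
  where open Spaces k n
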